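{- Let $f$ be an additive function taking nonnegative integer values with $f(p)\ge1$ for every prime $p$. Then every positive integer is $f$-practical if and only if $f(p^k)\le 1+\sum_{i=0}^{k-1}f(p^i)$ holds for every prime $p$ and every positive integer $k$.
   Context: $f$ is additive means $f(ab)=f(a)+f(b)$ whenever $\gcd(a,b)=1$ (so $f(1)=0$). $S_f(n)=\sum_{d\mid n}f(d)$, and $n$ is $f$-practical if every positive integer $m\le S_f(n)$ can be written as $\sum_{d\in\mathcal{D}}f(d)$ for some set $\mathcal{D}$ of divisors of $n$. -}

module Defs where

open import Data.Nat using (ℕ; zero; suc; _+_; _*_; _^_; _≤_; _<_)
open import Data.Nat.Divisibility using (_∣_; _∣?_)
open import Data.Nat.Coprimality using (Coprime)
open import Data.Nat.Primality using (Prime)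
open import Data.List using (List; map; filter; upTo; applyUpTo)
open import Data.Nat.ListAction using (sum)
open import Data.List.Relation.Binary.Sublist.Propositional using (_⊆_)
open import Data.Product using (Σ; _×_)
open import Relation.Binary.PropositionalEquality using (_≡_)

Additive : (ℕ → ℕ) → Set
Additive f = ∀ a b → 1 ≤ a → 1 ≤ b → Coprime a b → f (a * b) ≡ f a + f b

divisors : ℕ → List ℕ
divisors n = filter (_∣? n) (applyUpTo suc n)

S : (ℕ → ℕ) → ℕ → ℕ
S f n = sum (map f (divisors n))

-- n is f-practical: every m with 1 ≤ m ≤ S_f(n) is Σ_{d ∈ D} f(d)
-- for some set D of divisors of n (a sublist of the duplicate-free list
-- of divisors, i.e. a subset).
Practical : (ℕ → ℕ) → ℕ → Set
Practical f n = ∀ m → 1 ≤ m → m ≤ S f n →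
  Σ (List ℕ) λ D → (D ⊆ divisors n) × (sum (map f D) ≡ m)

{-# OPTIONS --safe #-}
module Submission where

-- Call a list of naturals complete if every m ≤ its sum is the sum of a
-- sublist; n is f-practical iff the values f(d), d ∣ n, form a complete list.
-- Prepending x to a complete list L keeps it complete iff x ≤ 1 + sum L.  For
-- n = p^k m with p ∤ m the divisors of n split into the blocks p^j · (divisors
-- of m), and by additivity the j-th block consists of values
-- f(p^j) + f(e) ≤ f(p^j) + S_f(m); so the prime-power condition lets the blocks
-- be added one at a time, and strong induction on n shows sufficiency.
-- Conversely, the divisors of p^k are p^0, …, p^k, and 1 + Σ_{i<k} f(p^i) is a
-- subset sum of their values only if f(p^k) does not exceed it.

open import Defs
open import Data.Nat
open import Data.Nat.Properties
open import Algebra.Properties.CommutativeSemigroup +-commutativeSemigroup using (x∙yz≈y∙xz)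
open import Data.Nat.Coprimality as Coprime using (Coprime; coprime-divisor; 1-coprimeTo)
open import Data.Nat.Divisibility
open import Data.Nat.Induction using (<-rec)
open import Data.Nat.ListAction using (sum; product)
open import Data.Nat.ListAction.Properties using (sum-++; sum-↭)
open import Data.Nat.Primality using (Prime; ¬prime[1]; prime⇒irreducible; prime⇒nonZero; prime⇒nonTrivial)
open import Data.Nat.Primality.Factorisation using (factorise)
open import Data.List using (List; []; _∷_; _++_; map; upTo; applyUpTo)
open import Data.List.Properties using (map-++; map-cong; map-id; upTo-∷ʳ)
open import Data.List.Membership.Propositional using (_∈_)
open import Data.List.Membership.Propositional.Properties
  using (∈-filter⁺; ∈-filter⁻; ∈-applyUpTo⁺; ∈-applyUpTo⁻; ∈-map⁺; ∈-map⁻; ∈-++⁺ˡ; ∈-++⁺ʳ; ∈-++⁻)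
open import Data.List.Membership.Propositional.Properties.WithK using (unique∧set⇒bag)
open import Data.List.Relation.Binary.BagAndSetEquality using (∼bag⇒↭)
open import Data.List.Relation.Binary.Permutation.Propositional using (_↭_; refl; prep; swap; trans; ↭-sym)
import Data.List.Relation.Binary.Permutation.Propositional.Properties as ↭
open import Data.List.Relation.Binary.Sublist.Propositional using (_⊆_; []; _∷_; _∷ʳ_; minimum)
import Data.List.Relation.Binary.Sublist.Propositional.Properties as ⊆
open import Data.List.Relation.Unary.All as All using (All)
open import Data.List.Relation.Unary.Any using (here; there)
open import Data.List.Relation.Unary.Unique.Propositional using (Unique)
import Data.List.Relation.Unary.Unique.Propositional.Properties as Unique
open import Data.Empty using (⊥-elim)
open import Data.Product using (∃-syntax; _×_; _,_; proj₁; proj₂)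
open import Data.Sum using (inj₁; inj₂)
open import Function.Base using (_∘_)
open import Function.Bundles using (_⇔_; mk⇔; Equivalence)
open import Relation.Binary.PropositionalEquality as ≡ using (_≡_; refl; sym; cong; subst; module ≡-Reasoning)
open import Relation.Nullary using (¬_; yes; no)

SublistSum : List ℕ → ℕ → Set
SublistSum L m = ∃[ D ] D ⊆ L × sum D ≡ m

Complete : List ℕ → Set
Complete L = ∀ m → m ≤ sum L → SublistSum L m

sum-mono-⊆ : ∀ {D L} → D ⊆ L → sum D ≤ sum L
sum-mono-⊆ [] = ≤-refl
sum-mono-⊆ (y ∷ʳ D⊆L) = ≤-trans (sum-mono-⊆ D⊆L) (m≤n+m _ y)
sum-mono-⊆ (refl ∷ D⊆L) = +-monoʳ-≤ _ (sum-mono-⊆ D⊆L)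

∈⇒≤sum : ∀ {x L} → x ∈ L → x ≤ sum L
∈⇒≤sum {x} {_ ∷ L} (here refl) = m≤m+n x (sum L)
∈⇒≤sum {x} {y ∷ L} (there x∈L) = ≤-trans (∈⇒≤sum x∈L) (m≤n+m (sum L) y)

sublistSum-∷ʳ : ∀ x {L m} → SublistSum L m → SublistSum (x ∷ L) m
sublistSum-∷ʳ x (D , D⊆L , ΣD) = D , x ∷ʳ D⊆L , ΣD

sublistSum-∷ : ∀ x {L m} → SublistSum L m → SublistSum (x ∷ L) (x + m)
sublistSum-∷ x (D , D⊆L , ΣD) = x ∷ D , refl ∷ D⊆L , cong (x +_) ΣD

sublistSum-↭ : ∀ {L L′ m} → L ↭ L′ → SublistSum L m → SublistSum L′ m
sublistSum-↭ refl s = s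
sublistSum-↭ (prep x L↭L′) (D , _ ∷ʳ D⊆L , ΣD) =
  sublistSum-∷ʳ x (sublistSum-↭ L↭L′ (D , D⊆L , ΣD))
sublistSum-↭ (prep x L↭L′) (_ ∷ D , refl ∷ D⊆L , refl) =
  sublistSum-∷ x (sublistSum-↭ L↭L′ (D , D⊆L , refl))
sublistSum-↭ (swap x y L↭L′) (D , _ ∷ʳ _ ∷ʳ D⊆L , ΣD) =
  sublistSum-∷ʳ y (sublistSum-∷ʳ x (sublistSum-↭ L↭L′ (D , D⊆L , ΣD)))
sublistSum-↭ (swap x y L↭L′) (_ ∷ D , _ ∷ʳ refl ∷ D⊆L , refl) =
  sublistSum-∷ y (sublistSum-∷ʳ x (sublistSum-↭ L↭L′ (D , D⊆L , refl)))
sublistSum-↭ (swap x y L↭L′) (_ ∷ D , refl ∷ _ ∷ʳ D⊆L , refl) =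
  sublistSum-∷ʳ y (sublistSum-∷ x (sublistSum-↭ L↭L′ (D , D⊆L , refl)))
sublistSum-↭ (swap x y L↭L′) (_ ∷ _ ∷ D , refl ∷ refl ∷ D⊆L , refl) =
  subst (SublistSum _) (x∙yz≈y∙xz y x (sum D))
    (sublistSum-∷ y (sublistSum-∷ x (sublistSum-↭ L↭L′ (D , D⊆L , refl))))
sublistSum-↭ (trans L↭L′ L′↭L″) s = sublistSum-↭ L′↭L″ (sublistSum-↭ L↭L′ s)

complete-↭ : ∀ {L L′} → L ↭ L′ → Complete L → Complete L′
complete-↭ L↭L′ c m m≤ΣL′ =
  sublistSum-↭ L↭L′ (c m (subst (m ≤_) (sym (sum-↭ L↭L′)) m≤ΣL′))

complete-[] : Complete []
complete-[] zero _ = [] , [] , refl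

complete-∷ : ∀ {x L} → x ≤ suc (sum L) → Complete L → Complete (x ∷ L)
complete-∷ {x} {L} x≤1+ΣL c m m≤x+ΣL with m ≤? sum L
... | yes m≤ΣL = sublistSum-∷ʳ x (c m m≤ΣL)
... | no m≰ΣL = subst (SublistSum (x ∷ L)) (m+[n∸m]≡n x≤m) (sublistSum-∷ x (c (m ∸ x) m∸x≤ΣL))
  where
  x≤m : x ≤ m
  x≤m = ≤-trans x≤1+ΣL (≰⇒> m≰ΣL)
  m∸x≤ΣL : m ∸ x ≤ sum L
  m∸x≤ΣL = subst (m ∸ x ≤_) (m+n∸m≡n x (sum L)) (∸-monoˡ-≤ x m≤x+ΣL)

complete-++ : ∀ M {L} → All (_≤ suc (sum L)) M → Complete L → Complete (M ++ L)
complete-++ [] _ c = c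
complete-++ (x ∷ M) {L} (x≤1+ΣL All.∷ M≤1+ΣL) c =
  complete-∷ (≤-trans x≤1+ΣL (s≤s ΣL≤ΣM++L)) (complete-++ M M≤1+ΣL c)
  where
  ΣL≤ΣM++L : sum L ≤ sum (M ++ L)
  ΣL≤ΣM++L = subst (sum L ≤_) (sym (sum-++ M L)) (m≤n+m (sum L) (sum M))

¬complete-∷ : ∀ {x L} → 2 + sum L ≤ x → ¬ Complete (x ∷ L)
¬complete-∷ {x} {L} 2+ΣL≤x c
  with c (suc (sum L)) (≤-trans (n≤1+n _) (≤-trans 2+ΣL≤x (m≤m+n x (sum L))))
... | D , _ ∷ʳ D⊆L , ΣD = 1+n≰n (subst (_≤ sum L) ΣD (sum-mono-⊆ D⊆L))
... | _ ∷ D , refl ∷ _ , ΣD = 1+n≰n (≤-trans 2+ΣL≤x (subst (x ≤_) ΣD (m≤m+n x (sum D))))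

⊆-map⁻ : ∀ (f : ℕ → ℕ) {E xs} → E ⊆ map f xs → ∃[ D ] D ⊆ xs × map f D ≡ E
⊆-map⁻ f {xs = []} [] = [] , [] , refl
⊆-map⁻ f {xs = x ∷ xs} (_ ∷ʳ E⊆) with ⊆-map⁻ f E⊆
... | D , D⊆ , refl = D , x ∷ʳ D⊆ , refl
⊆-map⁻ f {xs = x ∷ xs} (refl ∷ E⊆) with ⊆-map⁻ f E⊆
... | D , D⊆ , refl = x ∷ D , refl ∷ D⊆ , refl

practical⇔complete : ∀ f n → Practical f n ⇔ Complete (map f (divisors n))
practical⇔complete f n = mk⇔ to from
  where
  to : Practical f n → Complete (map f (divisors n))
  to practical zero _ = [] , minimum _ , refl
  to practical m@(suc _) m≤S with practical m (s≤s z≤n) m≤S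
  ... | D , D⊆ , ΣfD = map f D , ⊆.map⁺ f D⊆ , ΣfD
  from : Complete (map f (divisors n)) → Practical f n
  from complete m _ m≤S with complete m m≤S
  ... | E , E⊆ , ΣE with ⊆-map⁻ f E⊆
  ...   | D , D⊆ , refl = D , D⊆ , ΣE

∈-divisors⁻ : ∀ {n d} → d ∈ divisors n → d ∣ n × 1 ≤ d
∈-divisors⁻ {n} d∈ with ∈-filter⁻ (_∣? n) {xs = applyUpTo suc n} d∈
... | d∈upTo , d∣n with ∈-applyUpTo⁻ suc d∈upTo
...   | _ , _ , refl = d∣n , s≤s z≤n

∈-divisors⁺ : ∀ {n d} → 1 ≤ n → d ∣ n → d ∈ divisors n
∈-divisors⁺ {suc n} {zero} _ 0∣n with () ← 0∣⇒≡0 0∣n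
∈-divisors⁺ {suc n} {suc d} _ d∣n =
  ∈-filter⁺ (_∣? suc n) (∈-applyUpTo⁺ suc (s≤s (s≤s⁻¹ (∣⇒≤ d∣n)))) d∣n

divisors-unique : ∀ n → Unique (divisors n)
divisors-unique n =
  Unique.filter⁺ (_∣? n) (Unique.applyUpTo⁺₁ suc n (λ i<j _ → <⇒≢ i<j ∘ suc-injective))

coprime-*ˡ : ∀ {a b e} → Coprime a e → Coprime b e → Coprime (a * b) e
coprime-*ˡ {a} {b} {e} a⊥e b⊥e {d} (d∣ab , d∣e) = b⊥e (coprime-divisor d⊥a d∣ab , d∣e)
  where
  d⊥a : Coprime d a
  d⊥a (c∣d , c∣a) = a⊥e (c∣a , ∣-trans c∣d d∣e)

coprime-^ˡ : ∀ {a e} → Coprime a e → ∀ j → Coprime (a ^ j) e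
coprime-^ˡ {e = e} a⊥e zero = 1-coprimeTo e
coprime-^ˡ a⊥e (suc j) = coprime-*ˡ a⊥e (coprime-^ˡ a⊥e j)

prime∤⇒coprime : ∀ {p e} → Prime p → ¬ p ∣ e → Coprime p e
prime∤⇒coprime p-prime p∤e (d∣p , d∣e) with prime⇒irreducible p-prime d∣p
... | inj₁ d≡1 = d≡1
... | inj₂ refl = ⊥-elim (p∤e d∣e)

^-monoʳ-∣ : ∀ a {i j} → i ≤ j → a ^ i ∣ a ^ j
^-monoʳ-∣ a {i} {j} i≤j = divides (a ^ (j ∸ i)) (begin
  a ^ j                ≡⟨ cong (a ^_) (m+[n∸m]≡n i≤j) ⟨
  a ^ (i + (j ∸ i))    ≡⟨ ^-distribˡ-+-* a i (j ∸ i) ⟩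
  a ^ i * a ^ (j ∸ i)  ≡⟨ *-comm (a ^ i) _ ⟩
  a ^ (j ∸ i) * a ^ i  ∎)
  where open ≡-Reasoning

^-suc-∣⇒∣ : ∀ a .{{_ : NonZero a}} i {e} → a ^ suc i ∣ a ^ i * e → a ∣ e
^-suc-∣⇒∣ a i {e} a^[1+i]∣a^i*e =
  *-cancelˡ-∣ (a ^ i) {{m^n≢0 a i}} (subst (_∣ a ^ i * e) (*-comm a (a ^ i)) a^[1+i]∣a^i*e)

module _ {p} (p-prime : Prime p) where

  private instance
    p≢0 : NonZero p
    p≢0 = prime⇒nonZero p-prime

  p-adicSplit : ∀ x → 1 ≤ x → ∃[ j ] ∃[ e ] x ≡ p ^ j * e × ¬ p ∣ e
  p-adicSplit = <-rec _ split
    where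
    split : ∀ x → (∀ {y} → y < x → 1 ≤ y → ∃[ j ] ∃[ e ] y ≡ p ^ j * e × ¬ p ∣ e) →
            1 ≤ x → ∃[ j ] ∃[ e ] x ≡ p ^ j * e × ¬ p ∣ e
    split x rec 1≤x with p ∣? x
    ... | no p∤x = 0 , x , sym (*-identityˡ x) , p∤x
    ... | yes (divides q x≡q*p) with rec q<x 1≤q
      where
      1≤q : 1 ≤ q
      1≤q = n≢0⇒n>0 λ { refl → <⇒≱ 1≤x (≤-reflexive x≡q*p) }
      q<x : q < x
      q<x = subst (q <_) (sym x≡q*p) (m<m*n q p {{>-nonZero 1≤q}} (nonTrivial⇒n>1 p {{prime⇒nonTrivial p-prime}}))
    ... | j , e , q≡p^j*e , p∤e = suc j , e , x≡p^[1+j]*e , p∤e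
      where
      open ≡-Reasoning
      x≡p^[1+j]*e : x ≡ p ^ suc j * e
      x≡p^[1+j]*e = begin
        x                ≡⟨ x≡q*p ⟩
        q * p            ≡⟨ cong (_* p) q≡p^j*e ⟩
        p ^ j * e * p    ≡⟨ *-comm (p ^ j * e) p ⟩
        p * (p ^ j * e)  ≡⟨ *-assoc p (p ^ j) e ⟨
        p ^ suc j * e    ∎

  p-adicSplit-∣ : ∀ n → 1 ≤ n → p ∣ n → ∃[ k ] ∃[ m ] n ≡ p ^ k * m × ¬ p ∣ m × 1 ≤ m × m < n
  p-adicSplit-∣ n 1≤n p∣n with p-adicSplit n 1≤n
  ... | zero , m , n≡1*m , p∤m = ⊥-elim (p∤m (subst (p ∣_) (≡.trans n≡1*m (*-identityˡ m)) p∣n))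
  ... | suc k , m , n≡p^k*m , p∤m = suc k , m , n≡p^k*m , p∤m , 1≤m , m<n
    where
    1≤m : 1 ≤ m
    1≤m = n≢0⇒n>0 λ { refl → <⇒≱ 1≤n (≤-reflexive (≡.trans n≡p^k*m (*-zeroʳ (p ^ suc k)))) }
    1<p^[1+k] : 1 < p ^ suc k
    1<p^[1+k] = ≤-trans (nonTrivial⇒n>1 p {{prime⇒nonTrivial p-prime}}) (m≤m*n p (p ^ k) {{m^n≢0 p k}})
    m<n : m < n
    m<n = subst (m <_) (≡.trans (*-comm m (p ^ suc k)) (sym n≡p^k*m)) (m<m*n m (p ^ suc k) {{>-nonZero 1≤m}} 1<p^[1+k])

primeFactor : ∀ n → 2 ≤ n → ∃[ p ] Prime p × p ∣ n
primeFactor 1 (s≤s ())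
primeFactor n@(suc (suc _)) _ with factorise n
... | record { factors = [] ; isFactorisation = () }
... | record { factors = p ∷ ps ; isFactorisation = n≡p*Πps ; factorsPrime = p-prime All.∷ _ } =
  p , p-prime , divides (product ps) (≡.trans n≡p*Πps (*-comm p (product ps)))

module PrimePowerBlocks {p} (p-prime : Prime p) {m} (1≤m : 1 ≤ m) (p∤m : ¬ p ∣ m) where

  private instance
    p≢0 : NonZero p
    p≢0 = prime⇒nonZero p-prime

  block : ℕ → List ℕ
  block j = map (p ^ j *_) (divisors m)

  blocks : ℕ → List ℕ
  blocks zero = block 0
  blocks (suc k) = block (suc k) ++ blocks k

  ∈-blocks⁺ : ∀ k {i e} → i ≤ k → e ∈ divisors m → p ^ i * e ∈ blocks k
  ∈-blocks⁺ zero z≤n e∈ = ∈-map⁺ (p ^ 0 *_) e∈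
  ∈-blocks⁺ (suc k) i≤1+k e∈ with m≤n⇒m<n∨m≡n i≤1+k
  ... | inj₂ refl = ∈-++⁺ˡ (∈-map⁺ (p ^ suc k *_) e∈)
  ... | inj₁ i<1+k = ∈-++⁺ʳ (block (suc k)) (∈-blocks⁺ k (s≤s⁻¹ i<1+k) e∈)

  ∈-blocks⁻ : ∀ k {x} → x ∈ blocks k → ∃[ i ] ∃[ e ] i ≤ k × e ∈ divisors m × x ≡ p ^ i * e
  ∈-blocks⁻ zero x∈ with ∈-map⁻ (p ^ 0 *_) x∈
  ... | e , e∈ , x≡ = 0 , e , z≤n , e∈ , x≡
  ∈-blocks⁻ (suc k) x∈ with ∈-++⁻ (block (suc k)) x∈
  ... | inj₁ x∈block with ∈-map⁻ (p ^ suc k *_) x∈block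
  ...   | e , e∈ , x≡ = suc k , e , ≤-refl , e∈ , x≡
  ∈-blocks⁻ (suc k) x∈ | inj₂ x∈blocks with ∈-blocks⁻ k x∈blocks
  ...   | i , e , i≤k , e∈ , x≡ = i , e , m≤n⇒m≤1+n i≤k , e∈ , x≡

  p∤divisor : ∀ {e} → e ∈ divisors m → ¬ p ∣ e
  p∤divisor e∈ p∣e = p∤m (∣-trans p∣e (proj₁ (∈-divisors⁻ e∈)))

  block-unique : ∀ j → Unique (block j)
  block-unique j = Unique.map⁺ (*-cancelˡ-≡ _ _ (p ^ j) {{m^n≢0 p j}}) (divisors-unique m)

  block-disjoint : ∀ k {x} → x ∈ block (suc k) → ¬ x ∈ blocks k
  block-disjoint k x∈block x∈blocks with ∈-map⁻ (p ^ suc k *_) x∈block | ∈-blocks⁻ k x∈blocks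
  ... | e , _ , refl | i , e′ , i≤k , e′∈ , p^[1+k]*e≡p^i*e′ =
    p∤divisor e′∈ (^-suc-∣⇒∣ p i (subst (p ^ suc i ∣_) p^[1+k]*e≡p^i*e′
      (∣-trans (^-monoʳ-∣ p (s≤s i≤k)) (m∣m*n e))))

  blocks-unique : ∀ k → Unique (blocks k)
  blocks-unique zero = block-unique 0
  blocks-unique (suc k) =
    Unique.++⁺ (block-unique (suc k)) (blocks-unique k) (λ (x∈block , x∈blocks) → block-disjoint k x∈block x∈blocks)

  1≤p^k*m : ∀ k → 1 ≤ p ^ k * m
  1≤p^k*m k = *-mono-≤ (m^n>0 p k) 1≤m

  blocks⊆divisors : ∀ k {x} → x ∈ blocks k → x ∈ divisors (p ^ k * m)
  blocks⊆divisors k x∈ with ∈-blocks⁻ k x∈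
  ... | i , e , i≤k , e∈ , refl =
    ∈-divisors⁺ (1≤p^k*m k) (*-pres-∣ (^-monoʳ-∣ p i≤k) (proj₁ (∈-divisors⁻ e∈)))

  divisors⊆blocks : ∀ k {x} → x ∈ divisors (p ^ k * m) → x ∈ blocks k
  divisors⊆blocks k x∈ with ∈-divisors⁻ {p ^ k * m} x∈
  ... | x∣n , 1≤x with p-adicSplit p-prime _ 1≤x
  ... | j , e , refl , p∤e = ∈-blocks⁺ k j≤k (∈-divisors⁺ 1≤m e∣m)
    where
    j≤k : j ≤ k
    j≤k = ≮⇒≥ λ k<j → p∤m (^-suc-∣⇒∣ p k (∣-trans (^-monoʳ-∣ p k<j) (∣-trans (m∣m*n e) x∣n)))
    e∣m : e ∣ m
    e∣m = coprime-divisor (Coprime.sym (coprime-^ˡ (prime∤⇒coprime p-prime p∤e) k))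
            (∣-trans (n∣m*n (p ^ j)) x∣n)

  blocks↭divisors : ∀ k → blocks k ↭ divisors (p ^ k * m)
  blocks↭divisors k = ∼bag⇒↭ (unique∧set⇒bag (blocks-unique k) (divisors-unique (p ^ k * m))
    (mk⇔ (blocks⊆divisors k) (divisors⊆blocks k)))

powerSum : (ℕ → ℕ) → ℕ → ℕ → ℕ
powerSum f p k = sum (map (λ i → f (p ^ i)) (upTo k))

powerSum-suc : ∀ f p k → powerSum f p (suc k) ≡ powerSum f p k + f (p ^ k)
powerSum-suc f p k = begin
  sum (map g (upTo (suc k)))        ≡⟨ cong (λ is → sum (map g is)) (upTo-∷ʳ k) ⟨
  sum (map g (upTo k ++ k ∷ []))    ≡⟨ cong sum (map-++ g (upTo k) (k ∷ [])) ⟩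
  sum (map g (upTo k) ++ g k ∷ [])  ≡⟨ sum-++ (map g (upTo k)) (g k ∷ []) ⟩
  powerSum f p k + (g k + 0)        ≡⟨ cong (powerSum f p k +_) (+-identityʳ (g k)) ⟩
  powerSum f p k + g k              ∎
  where
  open ≡-Reasoning
  g : ℕ → ℕ
  g i = f (p ^ i)

PrimePowerCondition : (ℕ → ℕ) → Set
PrimePowerCondition f = ∀ p k → Prime p → 1 ≤ k → f (p ^ k) ≤ 1 + powerSum f p k

module _ (f : ℕ → ℕ) {p} (p-prime : Prime p) where

  open PrimePowerBlocks p-prime {1} ≤-refl (λ p∣1 → ¬prime[1] (subst Prime (∣1⇒≡1 p∣1) p-prime))

  sum-blocks[1] : ∀ j → sum (map f (blocks j)) ≡ powerSum f p (suc j)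
  sum-blocks[1] zero = refl
  sum-blocks[1] (suc j) = begin
    f (p ^ suc j * 1) + sum (map f (blocks j))  ≡⟨ ≡.cong₂ _+_ (cong f (*-identityʳ _)) (sum-blocks[1] j) ⟩
    f (p ^ suc j) + powerSum f p (suc j)        ≡⟨ +-comm (f (p ^ suc j)) _ ⟩
    powerSum f p (suc j) + f (p ^ suc j)        ≡⟨ powerSum-suc f p (suc j) ⟨
    powerSum f p (suc (suc j))                  ∎
    where open ≡-Reasoning

  complete⇒primePowerBound : ∀ k → Complete (map f (divisors (p ^ suc k))) →
                             f (p ^ suc k) ≤ 1 + powerSum f p (suc k)
  complete⇒primePowerBound k complete = ≮⇒≥ λ 1+Σ<f →
    ¬complete-∷ (2+Σ≤f 1+Σ<f) (complete-↭ (↭-sym (↭.map⁺ f (blocks↭divisors (suc k))))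
      (subst (λ n → Complete (map f (divisors n))) (sym (*-identityʳ (p ^ suc k))) complete))
    where
    2+Σ≤f : 1 + powerSum f p (suc k) < f (p ^ suc k) → 2 + sum (map f (blocks k)) ≤ f (p ^ suc k * 1)
    2+Σ≤f = ≡.subst₂ (λ s y → 2 + s ≤ f y) (sym (sum-blocks[1] k)) (sym (*-identityʳ (p ^ suc k)))

module _ {f : ℕ → ℕ} (f-additive : Additive f) where

  additive⇒f[1]≡0 : f 1 ≡ 0
  additive⇒f[1]≡0 = +-cancelˡ-≡ (f 1) (f 1) 0
    (≡.trans (sym (f-additive 1 1 ≤-refl ≤-refl (1-coprimeTo 1))) (sym (+-identityʳ (f 1))))

  module _ {p} (p-prime : Prime p) {m} (1≤m : 1 ≤ m) (p∤m : ¬ p ∣ m) where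

    open PrimePowerBlocks p-prime 1≤m p∤m

    f-block : ∀ j {e} → e ∈ divisors m → f (p ^ j * e) ≡ f (p ^ j) + f e
    f-block j e∈ = f-additive _ _ (m^n>0 p {{prime⇒nonZero p-prime}} j) (proj₂ (∈-divisors⁻ {m} e∈))
      (coprime-^ˡ (prime∤⇒coprime p-prime (p∤divisor e∈)) j)

    f[p^j]≤sum-block : ∀ j → f (p ^ j) ≤ sum (map f (block j))
    f[p^j]≤sum-block j = subst (_≤ sum (map f (block j))) (cong f (*-identityʳ (p ^ j)))
      (∈⇒≤sum (∈-map⁺ f (∈-map⁺ (p ^ j *_) (∈-divisors⁺ 1≤m (1∣ m)))))

    block0≡divisors : block 0 ≡ divisors m
    block0≡divisors = ≡.trans (map-cong *-identityˡ (divisors m)) (map-id (divisors m))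

    sum-blocks≥ : ∀ j → S f m + powerSum f p (suc j) ≤ sum (map f (blocks j))
    sum-blocks≥ zero = ≤-reflexive (begin
      S f m + (f 1 + 0)       ≡⟨ cong (λ y → S f m + (y + 0)) additive⇒f[1]≡0 ⟩
      S f m + 0               ≡⟨ +-identityʳ _ ⟩
      S f m                   ≡⟨ cong (λ ds → sum (map f ds)) block0≡divisors ⟨
      sum (map f (blocks 0))  ∎)
      where open ≡-Reasoning
    sum-blocks≥ (suc j) = begin
      S f m + powerSum f p (suc (suc j))
        ≡⟨ cong (S f m +_) (powerSum-suc f p (suc j)) ⟩
      S f m + (powerSum f p (suc j) + f (p ^ suc j))
        ≡⟨ +-assoc (S f m) _ _ ⟨
      S f m + powerSum f p (suc j) + f (p ^ suc j)
        ≡⟨ +-comm _ (f (p ^ suc j)) ⟩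
      f (p ^ suc j) + (S f m + powerSum f p (suc j))
        ≤⟨ +-mono-≤ (f[p^j]≤sum-block (suc j)) (sum-blocks≥ j) ⟩
      sum (map f (block (suc j))) + sum (map f (blocks j))
        ≡⟨ sum-++ (map f (block (suc j))) _ ⟨
      sum (map f (block (suc j)) ++ map f (blocks j))
        ≡⟨ cong sum (map-++ f (block (suc j)) (blocks j)) ⟨
      sum (map f (blocks (suc j)))
        ∎
      where open ≤-Reasoning

    complete-blocks : (∀ k → 1 ≤ k → f (p ^ k) ≤ 1 + powerSum f p k) →
                      Complete (map f (divisors m)) → ∀ k → Complete (map f (blocks k))
    complete-blocks bound complete[m] zero =
      subst (λ ds → Complete (map f ds)) (sym block0≡divisors) complete[m]
    complete-blocks bound complete[m] (suc k) =
      subst Complete (sym (map-++ f (block (suc k)) (blocks k)))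
        (complete-++ (map f (block (suc k))) (All.tabulate small) (complete-blocks bound complete[m] k))
      where
      small : ∀ {x} → x ∈ map f (block (suc k)) → x ≤ suc (sum (map f (blocks k)))
      small x∈ with ∈-map⁻ f x∈
      ... | y , y∈ , refl with ∈-map⁻ (p ^ suc k *_) y∈
      ...   | e , e∈ , refl = begin
        f (p ^ suc k * e)                   ≡⟨ f-block (suc k) e∈ ⟩
        f (p ^ suc k) + f e                 ≤⟨ +-mono-≤ (bound (suc k) (s≤s z≤n)) (∈⇒≤sum (∈-map⁺ f e∈)) ⟩
        1 + powerSum f p (suc k) + S f m    ≡⟨ cong suc (+-comm _ (S f m)) ⟩
        1 + (S f m + powerSum f p (suc k))  ≤⟨ s≤s (sum-blocks≥ k) ⟩
        suc (sum (map f (blocks k)))        ∎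
        where open ≤-Reasoning

  complete-divisors : PrimePowerCondition f → ∀ n → 1 ≤ n → Complete (map f (divisors n))
  complete-divisors bound = <-rec _ step
    where
    step : ∀ n → (∀ {m} → m < n → 1 ≤ m → Complete (map f (divisors m))) →
           1 ≤ n → Complete (map f (divisors n))
    step 1 _ _ = complete-∷ (subst (_≤ 1) (sym additive⇒f[1]≡0) z≤n) complete-[]
    step n@(suc (suc _)) complete<n 1≤n with primeFactor n (s≤s (s≤s z≤n))
    ... | p , p-prime , p∣n with p-adicSplit-∣ p-prime n 1≤n p∣n
    ...   | k , m , n≡p^k*m , p∤m , 1≤m , m<n =
      subst (λ n → Complete (map f (divisors n))) (sym n≡p^k*m)
        (complete-↭ (↭.map⁺ f (blocks↭divisors k))
          (complete-blocks p-prime 1≤m p∤m (λ j → bound p j p-prime) (complete<n m<n 1≤m) k))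
      where open PrimePowerBlocks p-prime 1≤m p∤m

corollary6p2 : (f : ℕ → ℕ) → Additive f → (∀ p → Prime p → 1 ≤ f p) →
    ((n : ℕ) → 1 ≤ n → Practical f n) ⇔
    ((p k : ℕ) → Prime p → 1 ≤ k →
      f (p ^ k) ≤ 1 + sum (map (λ i → f (p ^ i)) (upTo k)))
corollary6p2 f f-additive _ = mk⇔ necessary sufficient
  where
  open Equivalence
  necessary : (∀ n → 1 ≤ n → Practical f n) → PrimePowerCondition f
  necessary practical p (suc k) p-prime _ =
    complete⇒primePowerBound f p-prime k (to (practical⇔complete f (p ^ suc k))
      (practical (p ^ suc k) (m^n>0 p {{prime⇒nonZero p-prime}} (suc k))))
  sufficient : PrimePowerCondition f → ∀ n → 1 ≤ n → Practical f n
  sufficient bound n 1≤n = from (practical⇔complete f n) (complete-divisors f-additive bound n 1≤n)
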